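{- Let $A\subseteq\omega$ be intrinsically effectively densely computable. Then $A$ is computable.
   Context: For $S\subseteq\omega$ and $n\geq 1$, $\rho_n(S)=|S\cap\{0,\dots,n-1\}|/n$, $\overline{\rho}(S)=\limsup_n\rho_n(S)$. A set $S$ is intrinsically small if $\overline{\rho}(\pi(S))=0$ for every computable permutation $\pi$ of $\omega$. An effective dense description of $A$ is a total computable function $\varphi:\omega\to\{0,1,\square\}$ such that $\varphi(n)\in\{0,1\}$ implies $\varphi(n)=A(n)$; its error set is $\varphi^{ -1}(\{\square\})$. $A$ is intrinsically effectively densely computable if it has an effective dense description whose error set is intrinsically small. -}

module Defs where

open import Data.Nat using (ℕ; zero; suc; _*_; _≤_; _<_)
open import Data.Fin using (Fin)
open import Data.Vec using (Vec; []; _∷_; lookup)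
open import Data.Bool using (Bool; true; false)
open import Data.List using (List; length)
open import Data.List.Relation.Unary.All using (All)
open import Data.List.Relation.Unary.Unique.Propositional using (Unique)
open import Data.Product using (Σ; ∃; _×_; _,_)
open import Relation.Binary.PropositionalEquality using (_≡_)
open import Function.Definitions using (Bijective)

data Code : ℕ → Set where
  zer  : ∀ {n} → Code n
  succ : Code 1
  proj : ∀ {n} → Fin n → Code n
  comp : ∀ {m n} → Code m → Vec (Code n) m → Code n
  prec : ∀ {n} → Code n → Code (suc (suc n)) → Code (suc n)
  mu   : ∀ {n} → Code (suc n) → Code n

mutual
  data _[_]⇓_ : ∀ {n} → Code n → Vec ℕ n → ℕ → Set where
    zer⇓  : ∀ {n} {xs : Vec ℕ n} → zer [ xs ]⇓ 0
    succ⇓ : ∀ {x} → succ [ x ∷ [] ]⇓ suc x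
    proj⇓ : ∀ {n} {i : Fin n} {xs} → proj i [ xs ]⇓ lookup xs i
    comp⇓ : ∀ {m n} {f : Code m} {gs : Vec (Code n) m} {xs ys y} →
            gs [ xs ]⇓* ys → f [ ys ]⇓ y → comp f gs [ xs ]⇓ y
    prec0⇓ : ∀ {n} {g : Code n} {h : Code (suc (suc n))} {xs y} →
             g [ xs ]⇓ y → prec g h [ 0 ∷ xs ]⇓ y
    precS⇓ : ∀ {n} {g : Code n} {h : Code (suc (suc n))} {xs k r y} →
             prec g h [ k ∷ xs ]⇓ r → h [ k ∷ r ∷ xs ]⇓ y →
             prec g h [ suc k ∷ xs ]⇓ y
    mu⇓   : ∀ {n} {f : Code (suc n)} {xs y} →
            f [ y ∷ xs ]⇓ 0 →
            (∀ z → z < y → Σ ℕ λ k → f [ z ∷ xs ]⇓ suc k) →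
            mu f [ xs ]⇓ y

  data _[_]⇓*_ : ∀ {m n} → Vec (Code n) m → Vec ℕ n → Vec ℕ m → Set where
    []⇓  : ∀ {n} {xs : Vec ℕ n} → [] [ xs ]⇓* []
    _∷⇓_ : ∀ {m n} {g : Code n} {gs : Vec (Code n) m} {xs y ys} →
           g [ xs ]⇓ y → gs [ xs ]⇓* ys → (g ∷ gs) [ xs ]⇓* (y ∷ ys)

Computable : (ℕ → ℕ) → Set
Computable f = ∃ λ (c : Code 1) → ∀ x → c [ x ∷ [] ]⇓ f x

-- Subsets of ω are given by characteristic functions ℕ → Bool
toℕ : Bool → ℕ
toℕ false = 0
toℕ true  = 1

ComputableSet : (ℕ → Bool) → Set
ComputableSet A = Computable (λ n → toℕ (A n))

-- For a set P ⊆ ω, ρ̄(P) = 0 iff for every k,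
-- eventually (for n ≥ N) |P ∩ {0,…,n-1}| ≤ n/(k+1); the cardinality bound
-- is expressed as: every duplicate-free list of elements of P ∩ [0,n) has
-- length ℓ with (k+1)·ℓ ≤ n.

UpperDensityZero : (ℕ → Set) → Set
UpperDensityZero P =
  ∀ (k : ℕ) → ∃ λ (N : ℕ) → ∀ (n : ℕ) → N ≤ n →
    ∀ (xs : List ℕ) → Unique xs → All (λ x → x < n × P x) xs →
    suc k * length xs ≤ n

ComputablePermutation : (ℕ → ℕ) → Set
ComputablePermutation π = Computable π × Bijective _≡_ _≡_ π

Image : (ℕ → ℕ) → (ℕ → Set) → (ℕ → Set)
Image π S m = ∃ λ n → S n × π n ≡ m

IntrinsicallySmall : (ℕ → Set) → Set
IntrinsicallySmall S = ∀ (π : ℕ → ℕ) → ComputablePermutation π → UpperDensityZero (Image π S)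

data Tri : Set where
  bit : Bool → Tri
  □   : Tri

encodeTri : Tri → ℕ
encodeTri (bit b) = toℕ b
encodeTri □       = 2

IsEffectiveDenseDescription : (ℕ → Tri) → (ℕ → Bool) → Set
IsEffectiveDenseDescription φ A =
  Computable (λ n → encodeTri (φ n)) × (∀ n b → φ n ≡ bit b → b ≡ A n)

ErrorSet : (ℕ → Tri) → ℕ → Set
ErrorSet φ n = φ n ≡ □

IntrinsicallyEffectivelyDenselyComputable : (ℕ → Bool) → Set
IntrinsicallyEffectivelyDenselyComputable A =
  ∃ λ (φ : ℕ → Tri) → IsEffectiveDenseDescription φ A × IntrinsicallySmall (ErrorSet φ)

-- The error set E of an effective dense description is decidable, since the
-- description computes it.  If E is finite, A differs from the description only
-- at finitely many points and is computable.  If E and its complement are both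
-- infinite, the computable permutation enumerating E onto the even numbers and
-- the complement onto the odd numbers maps E to a set of upper density 1/2; if
-- E is cofinite, E itself has upper density 1.  Both contradict intrinsic
-- smallness; excluded middle decides which case occurs.

module Submission where

open import Defs
open import Axiom.DoubleNegationElimination using (em⇒dne)
open import Axiom.ExcludedMiddle using (ExcludedMiddle)
open import Data.Bool using (Bool; true; false; not; if_then_else_)
open import Data.Bool.Properties using (¬-not; not-injective)
open import Data.Empty using (⊥-elim)
open import Data.Fin.Patterns using (0F; 1F; 2F)
open import Data.List using (applyUpTo; length)
open import Data.List.Properties using (length-applyUpTo)
import Data.List.Relation.Unary.All as All
import Data.List.Relation.Unary.All.Properties as All
import Data.List.Relation.Unary.Unique.Propositional.Properties as Unique
open import Data.Nat
open import Data.Nat.Properties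
open import Data.Product using (∃; _×_; _,_; proj₁; proj₂; map₁; map₂)
open import Data.Sum using (_⊎_; inj₁; inj₂)
open import Data.Vec using ([]; _∷_)
open import Function using (_∘_; flip; id)
import Function.Construct.Identity as Identity
open import Function.Definitions using (Injective; Surjective)
open import Level using (0ℓ)
open import Relation.Binary.PropositionalEquality
open import Relation.Binary.Definitions using (tri<; tri≈; tri>)
open import Relation.Nullary using (¬_; yes; no)

Computable₂ : (ℕ → ℕ → ℕ) → Set
Computable₂ f = ∃ λ (c : Code 2) → ∀ x y → c [ x ∷ y ∷ [] ]⇓ f x y

Computable₃ : (ℕ → ℕ → ℕ → ℕ) → Set
Computable₃ f = ∃ λ (c : Code 3) → ∀ x y z → c [ x ∷ y ∷ z ∷ [] ]⇓ f x y z

Computable-cong : ∀ {f g} → (∀ n → f n ≡ g n) → Computable f → Computable g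
Computable-cong f≗g (c , c⇓f) = c , λ n → subst (c [ n ∷ [] ]⇓_) (f≗g n) (c⇓f n)

∘-computable : ∀ {g f} → Computable g → Computable f → Computable (g ∘ f)
∘-computable (cg , cg⇓) (cf , cf⇓) =
  comp cg (cf ∷ []) , λ n → comp⇓ (cf⇓ n ∷⇓ []⇓) (cg⇓ _)

∘₂-computable : ∀ {g f₁ f₂} → Computable₂ g → Computable f₁ → Computable f₂ →
                Computable (λ n → g (f₁ n) (f₂ n))
∘₂-computable (cg , cg⇓) (c₁ , c₁⇓) (c₂ , c₂⇓) =
  comp cg (c₁ ∷ c₂ ∷ []) , λ n → comp⇓ (c₁⇓ n ∷⇓ (c₂⇓ n ∷⇓ []⇓)) (cg⇓ _ _)

∘₃-computable : ∀ {g f₁ f₂ f₃} → Computable₃ g →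
                Computable f₁ → Computable f₂ → Computable f₃ →
                Computable (λ n → g (f₁ n) (f₂ n) (f₃ n))
∘₃-computable (cg , cg⇓) (c₁ , c₁⇓) (c₂ , c₂⇓) (c₃ , c₃⇓) =
  comp cg (c₁ ∷ c₂ ∷ c₃ ∷ []) ,
  λ n → comp⇓ (c₁⇓ n ∷⇓ (c₂⇓ n ∷⇓ (c₃⇓ n ∷⇓ []⇓))) (cg⇓ _ _ _)

id-computable : Computable id
id-computable = proj 0F , λ _ → proj⇓

suc-computable : Computable suc
suc-computable = succ , λ _ → succ⇓

const-computable : ∀ a → Computable (λ _ → a)
const-computable zero    = zer , λ _ → zer⇓
const-computable (suc a) = ∘-computable suc-computable (const-computable a)

pred-computable : Computable pred
pred-computable = prec zer (proj 0F) , pred⇓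
  where
  pred⇓ : ∀ n → prec zer (proj 0F) [ n ∷ [] ]⇓ pred n
  pred⇓ zero    = prec0⇓ zer⇓
  pred⇓ (suc n) = precS⇓ (pred⇓ n) proj⇓

+-computable : Computable₂ _+_
+-computable = add , add⇓
  where
  add : Code 2
  add = prec (proj 0F) (comp succ (proj 1F ∷ []))
  add⇓ : ∀ x y → add [ x ∷ y ∷ [] ]⇓ (x + y)
  add⇓ zero    y = prec0⇓ proj⇓
  add⇓ (suc x) y = precS⇓ (add⇓ x y) (comp⇓ (proj⇓ ∷⇓ []⇓) succ⇓)

-- The recursion runs on the first argument, hence the flip.
∸-computable : Computable₂ (flip _∸_)
∸-computable = monus , monus⇓
  where
  monus : Code 2
  monus = prec (proj 0F) (comp (proj₁ pred-computable) (proj 1F ∷ []))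
  monus⇓ : ∀ x y → monus [ x ∷ y ∷ [] ]⇓ (y ∸ x)
  monus⇓ zero    y = prec0⇓ proj⇓
  monus⇓ (suc x) y = subst (monus [ suc x ∷ y ∷ [] ]⇓_) (pred[m∸n]≡m∸[1+n] y x)
    (precS⇓ (monus⇓ x y) (comp⇓ (proj⇓ ∷⇓ []⇓) (proj₂ pred-computable _)))

-- 2 * x unfolds to x + (x + 0).
2*-computable : ∀ {f} → Computable f → Computable (λ n → 2 * f n)
2*-computable fc =
  ∘₂-computable +-computable fc (∘₂-computable +-computable fc (const-computable 0))

ifPos : ℕ → ℕ → ℕ → ℕ
ifPos zero    x y = y
ifPos (suc _) x y = x

ifPos-toℕ : ∀ b {x y : ℕ} → ifPos (toℕ b) x y ≡ (if b then x else y)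
ifPos-toℕ true  = refl
ifPos-toℕ false = refl

ifPos-computable : Computable₃ ifPos
ifPos-computable = select , select⇓
  where
  select : Code 3
  select = prec (proj 1F) (proj 2F)
  select⇓ : ∀ b x y → select [ b ∷ x ∷ y ∷ [] ]⇓ ifPos b x y
  select⇓ zero    x y = prec0⇓ proj⇓
  select⇓ (suc b) x y = precS⇓ (select⇓ b x y) proj⇓

sumBelow : (ℕ → ℕ) → ℕ → ℕ
sumBelow f zero    = 0
sumBelow f (suc n) = f n + sumBelow f n

sumBelow-computable : ∀ {f} → Computable f → Computable (sumBelow f)
sumBelow-computable {f} (cf , cf⇓) = prec zer step , sum⇓
  where
  step : Code 2
  step = comp (proj₁ +-computable) (comp cf (proj 0F ∷ []) ∷ proj 1F ∷ [])
  sum⇓ : ∀ n → prec zer step [ n ∷ [] ]⇓ sumBelow f n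
  sum⇓ zero    = prec0⇓ zer⇓
  sum⇓ (suc n) = precS⇓ (sum⇓ n)
    (comp⇓ (comp⇓ (proj⇓ ∷⇓ []⇓) (cf⇓ n) ∷⇓ (proj⇓ ∷⇓ []⇓)) (proj₂ +-computable _ _))

eventuallyEqual-computable : ∀ B {f g} → Computable f →
                             (∀ n → B ≤ n → f n ≡ g n) → Computable g
eventuallyEqual-computable zero    fc f≗g = Computable-cong (λ n → f≗g n z≤n) fc
eventuallyEqual-computable (suc B) {f} {g} fc f≗g =
  eventuallyEqual-computable B patched-computable patched≗g
  where
  patched : ℕ → ℕ
  patched n = ifPos (n ∸ B) (f n) (g B)

  patched-computable : Computable patched
  patched-computable = ∘₃-computable ifPos-computable
    (∘₂-computable ∸-computable (const-computable B) id-computable)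
    fc (const-computable (g B))

  patched≗g : ∀ n → B ≤ n → patched n ≡ g n
  patched≗g n B≤n with m≤n⇒m<n∨m≡n B≤n
  ... | inj₂ refl rewrite n∸n≡0 B = refl
  ... | inj₁ B<n with n ∸ B | m<n⇒0<n∸m B<n
  ...   | suc _ | _ = f≗g n B<n

Unbounded : (ℕ → Bool) → Set
Unbounded q = ∀ m → ∃ λ n → m ≤ n × q n ≡ true

EventuallyFalse : (ℕ → Bool) → Set
EventuallyFalse q = ∃ λ B → ∀ n → B ≤ n → q n ≡ false

unbounded⊎eventuallyFalse : ExcludedMiddle 0ℓ → ∀ q → Unbounded q ⊎ EventuallyFalse q
unbounded⊎eventuallyFalse em q with em {EventuallyFalse q}
... | yes eventuallyFalse = inj₂ eventuallyFalse
... | no ¬eventuallyFalse = inj₁ λ m → em⇒dne em λ ¬trueAfter-m →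
  ¬eventuallyFalse (m , λ n m≤n → ¬-not λ qn → ¬trueAfter-m (n , m≤n , qn))

count : (ℕ → Bool) → ℕ → ℕ
count q = sumBelow (toℕ ∘ q)

module _ (q : ℕ → Bool) where

  count-mono : ∀ {m n} → m ≤ n → count q m ≤ count q n
  count-mono {n = zero} z≤n = ≤-refl
  count-mono {m} {suc n} m≤1+n with m≤n⇒m<n∨m≡n m≤1+n
  ... | inj₂ refl  = ≤-refl
  ... | inj₁ m<1+n = ≤-trans (count-mono (≤-pred m<1+n)) (m≤n+m (count q n) (toℕ (q n)))

  count-strict : ∀ {m n} → q m ≡ true → m < n → count q m < count q n
  count-strict {m} {n} qm m<n =
    subst (_≤ count q n) (cong (λ b → toℕ b + count q m) qm) (count-mono m<n)

  count-injective : ∀ {m n} → q m ≡ true → q n ≡ true → count q m ≡ count q n → m ≡ n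
  count-injective {m} {n} qm qn eq with <-cmp m n
  ... | tri< m<n _ _ = ⊥-elim (<-irrefl eq (count-strict qm m<n))
  ... | tri≈ _ m≡n _ = m≡n
  ... | tri> _ _ n<m = ⊥-elim (<-irrefl (sym eq) (count-strict qn n<m))

  -- The first k ≥ m with q k true is counted exactly like m.
  count-atNextTrue : ∀ {m n} → m ≤ n → q n ≡ true →
                     ∃ λ k → q k ≡ true × count q k ≡ count q m
  count-atNextTrue {m} m≤n qn with m≤n⇒∃[o]m+o≡n m≤n
  ... | o , refl = search m o qn
    where
    search : ∀ m o → q (m + o) ≡ true → ∃ λ k → q k ≡ true × count q k ≡ count q m
    search m zero    qm+0 = m , subst (λ x → q x ≡ true) (+-identityʳ m) qm+0 , refl
    search m (suc o) qm+o with q m in qm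
    ... | true  = m , qm , refl
    ... | false with search (suc m) o (subst (λ x → q x ≡ true) (+-suc m o) qm+o)
    ...   | k , qk , eq = k , qk , trans eq (cong (λ b → toℕ b + count q m) qm)

  count-surjective : Unbounded q → ∀ j → ∃ λ n → q n ≡ true × count q n ≡ j
  count-surjective unbounded zero with unbounded 0
  ... | n , 0≤n , qn = count-atNextTrue 0≤n qn
  count-surjective unbounded (suc j) with count-surjective unbounded j
  ... | n , qn , refl with unbounded (suc n)
  ...   | k , n<k , qk with count-atNextTrue n<k qk
  ...     | l , ql , eq = l , ql , trans eq (cong (λ b → toℕ b + count q n) qn)

even⊎odd : ∀ n → ∃ λ j → n ≡ 2 * j ⊎ n ≡ suc (2 * j)
even⊎odd zero = 0 , inj₁ refl
even⊎odd (suc n) with even⊎odd n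
... | j , inj₁ refl = j , inj₂ refl
... | j , inj₂ refl = suc j , inj₁ (sym (*-suc 2 j))

interleave : (ℕ → Bool) → ℕ → ℕ
interleave q n = if q n then 2 * count q n else suc (2 * count (not ∘ q) n)

toℕ-not : ∀ b → 1 ∸ toℕ b ≡ toℕ (not b)
toℕ-not true  = refl
toℕ-not false = refl

not-computable : ∀ {q} → ComputableSet q → ComputableSet (not ∘ q)
not-computable {q} qc =
  Computable-cong (toℕ-not ∘ q) (∘₂-computable ∸-computable qc (const-computable 1))

module _ (q : ℕ → Bool) where

  interleave-true : ∀ {n} → q n ≡ true → interleave q n ≡ 2 * count q n
  interleave-true qn rewrite qn = refl

  interleave-false : ∀ {n} → q n ≡ false → interleave q n ≡ suc (2 * count (not ∘ q) n)
  interleave-false qn rewrite qn = refl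

  interleave-injective : Injective _≡_ _≡_ (interleave q)
  interleave-injective {m} {n} eq with q m in qm | q n in qn
  ... | true  | true  = count-injective q qm qn (*-cancelˡ-≡ _ _ 2 eq)
  ... | true  | false = ⊥-elim (even≢odd (count q m) (count (not ∘ q) n) eq)
  ... | false | true  = ⊥-elim (even≢odd (count q n) (count (not ∘ q) m) (sym eq))
  ... | false | false =
    count-injective (not ∘ q) (cong not qm) (cong not qn) (*-cancelˡ-≡ _ _ 2 (suc-injective eq))

  interleave-even : Unbounded q → ∀ j → ∃ λ n → q n ≡ true × interleave q n ≡ 2 * j
  interleave-even unbounded j with count-surjective q unbounded j
  ... | n , qn , refl = n , qn , interleave-true qn

  interleave-odd : Unbounded (not ∘ q) → ∀ j → ∃ λ n → interleave q n ≡ suc (2 * j)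
  interleave-odd unbounded j with count-surjective (not ∘ q) unbounded j
  ... | n , qn , refl = n , interleave-false (not-injective qn)

  interleave-surjective : Unbounded q → Unbounded (not ∘ q) → Surjective _≡_ _≡_ (interleave q)
  interleave-surjective unbounded co-unbounded y with even⊎odd y
  ... | j , inj₁ refl with interleave-even unbounded j
  ...   | n , _ , eq = n , λ { refl → eq }
  interleave-surjective unbounded co-unbounded y
      | j , inj₂ refl with interleave-odd co-unbounded j
  ...   | n , eq = n , λ { refl → eq }

  interleave-computable : ComputableSet q → Computable (interleave q)
  interleave-computable qc = Computable-cong (λ n → ifPos-toℕ (q n))
    (∘₃-computable ifPos-computable qc
      (2*-computable (sumBelow-computable qc))
      (∘-computable suc-computable (2*-computable (sumBelow-computable (not-computable qc)))))

  interleave-computablePermutation : ComputableSet q → Unbounded q → Unbounded (not ∘ q) →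
                                     ComputablePermutation (interleave q)
  interleave-computablePermutation qc unbounded co-unbounded =
    interleave-computable qc ,
    interleave-injective ,
    interleave-surjective unbounded co-unbounded

id-computablePermutation : ComputablePermutation id
id-computablePermutation = id-computable , Identity.bijective _≡_

-- Counting the first M terms below a + (1 + d) M, density at most 1/(2 + d)
-- would give (2 + d) M ≤ a + (1 + d) M, which fails once M > a.
¬UpperDensityZero-progression : ∀ {P : ℕ → Set} a d → (∀ i → P (a + suc d * i)) →
                                ¬ UpperDensityZero P
¬UpperDensityZero-progression {P} a d P-progression upperDensityZero
  with upperDensityZero (suc d)
... | N , bound = <⇒≱ a<M M≤a
  where
  term : ℕ → ℕ
  term i = a + suc d * i

  term-mono : ∀ {i j} → i < j → term i < term j
  term-mono i<j = +-monoʳ-< a (*-monoʳ-< (suc d) i<j)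

  M : ℕ
  M = N + suc a

  a<M : a < M
  a<M = m≤n+m (suc a) N

  N≤term[M] : N ≤ term M
  N≤term[M] = ≤-trans (m≤m+n N (suc a)) (≤-trans (m≤n*m M (suc d)) (m≤n+m _ a))

  counted : suc (suc d) * length (applyUpTo term M) ≤ term M
  counted = bound (term M) N≤term[M] (applyUpTo term M)
    (Unique.applyUpTo⁺₁ term M (λ i<j _ → <⇒≢ (term-mono i<j)))
    (All.applyUpTo⁺₁ term M (λ {i} i<M → term-mono i<M , P-progression i))

  M≤a : M ≤ a
  M≤a = +-cancelʳ-≤ (suc d * M) M a
    (subst (_≤ term M) (cong (suc (suc d) *_) (length-applyUpTo term M)) counted)

UpperDensityZero-⊆ : ∀ {P Q : ℕ → Set} → (∀ {n} → Q n → P n) →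
                     UpperDensityZero P → UpperDensityZero Q
UpperDensityZero-⊆ Q⊆P upperDensityZero k with upperDensityZero k
... | N , bound = N , λ n N≤n xs unique all → bound n N≤n xs unique (All.map (map₂ Q⊆P) all)

IntrinsicallySmall-⊆ : ∀ {S T : ℕ → Set} → (∀ {n} → T n → S n) →
                       IntrinsicallySmall S → IntrinsicallySmall T
IntrinsicallySmall-⊆ T⊆S small π π-permutation =
  UpperDensityZero-⊆ (map₂ (map₁ T⊆S)) (small π π-permutation)

computable-intrinsicallySmall⇒eventuallyFalse :
  ExcludedMiddle 0ℓ → ∀ {q} → ComputableSet q →
  IntrinsicallySmall (λ n → q n ≡ true) → EventuallyFalse q
computable-intrinsicallySmall⇒eventuallyFalse em {q} qc small
  with unbounded⊎eventuallyFalse em q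
... | inj₂ eventuallyFalse = eventuallyFalse
... | inj₁ unbounded with unbounded⊎eventuallyFalse em (not ∘ q)
...   | inj₁ co-unbounded = ⊥-elim (¬UpperDensityZero-progression 0 1
          (interleave-even q unbounded)
          (small (interleave q) (interleave-computablePermutation q qc unbounded co-unbounded)))
...   | inj₂ (B , co-eventuallyFalse) = ⊥-elim (¬UpperDensityZero-progression B 0
          (λ i → _ , not-injective (co-eventuallyFalse _ (m≤m+n B _)) , refl)
          (small id id-computablePermutation))

isBox : Tri → Bool
isBox (bit _) = false
isBox □       = true

isBox⇒□ : ∀ {t} → isBox t ≡ true → t ≡ □
isBox⇒□ {□} _ = refl

pred-encodeTri : ∀ t → pred (encodeTri t) ≡ toℕ (isBox t)
pred-encodeTri (bit true)  = refl
pred-encodeTri (bit false) = refl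
pred-encodeTri □           = refl

isBox-computable : ∀ {φ} → Computable (λ n → encodeTri (φ n)) → ComputableSet (isBox ∘ φ)
isBox-computable {φ} φc = Computable-cong (pred-encodeTri ∘ φ) (∘-computable pred-computable φc)

description-correct : ∀ {φ A n} → IsEffectiveDenseDescription φ A →
                      isBox (φ n) ≡ false → encodeTri (φ n) ≡ toℕ (A n)
description-correct {φ} {n = n} (_ , sound) notBox with φ n in φn
... | bit b = cong toℕ (sound n b φn)

lemma5p2 : ExcludedMiddle 0ℓ → (A : ℕ → Bool) →
    IntrinsicallyEffectivelyDenselyComputable A → ComputableSet A
lemma5p2 em A (φ , description@(φ-computable , _) , small)
  with computable-intrinsicallySmall⇒eventuallyFalse em
         (isBox-computable φ-computable) (IntrinsicallySmall-⊆ isBox⇒□ small)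
... | B , noErrorFrom-B = eventuallyEqual-computable B φ-computable
        (λ n B≤n → description-correct description (noErrorFrom-B n B≤n))
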